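{- Let $a_1\le a_2$ and $b_1\le b_2$ be nonnegative integers with $a_1+a_2\ge 4$ and $b_1+b_2\ge 4$, and let $F_1=K_{a_1,a_2}$ and $F_2=K_{b_1}+K_{b_2}$. Then the set $\{F_1,F_2\}$ contains an element of each of the classes $\mathbb{K}$, $\mathbb{K}^c$, $\mathbb{S}$, $\mathbb{S}^c$ if and only if either both $a_1\le 1$ and $b_1\le 1$, or $a_1=a_2=b_1=b_2=2$.
   Context: All graphs are finite and simple, considered up to isomorphism. $K_{a,b}$ is the complete bipartite graph with parts of sizes $a$ and $b$ ($K_{0,b}$ being the edgeless graph on $b$ vertices), $K_n$ the complete graph on $n$ vertices ($K_0$ the graph with no vertices), and $G+H$ the disjoint union. $\mathbb{K}$ is the class of graphs that are disjoint unions of complete graphs in which at most one complete graph has more than two vertices; $\mathbb{S}$ is the class of forests in which every component is a star $K_{1,m}$ ($m\ge 0$); $\mathbb{K}^c$ and $\mathbb{S}^c$ are the classes of complements of graphs in $\mathbb{K}$ and $\mathbb{S}$, respectively. -}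

module Defs where

open import Data.Nat using (ℕ; zero; suc; _+_; _≤_; _<?_)
open import Data.Fin using (Fin; splitAt; _≟_)
open import Data.Bool using (Bool; true; false; not; if_then_else_)
open import Data.Sum using (_⊎_; inj₁; inj₂)
open import Data.Product using (Σ; _×_; _,_; ∃-syntax)
open import Data.List using (List; []; _∷_; length; filter; foldr; map)
open import Relation.Nullary using (does; yes; no)
open import Relation.Binary.PropositionalEquality using (_≡_; refl; sym)
open import Function.Bundles using (_↔_; Inverse)

record Graph : Set where
  field
    size   : ℕ
    adj    : Fin size → Fin size → Bool
    adjSym : ∀ i j → adj i j ≡ adj j i
    adjIrr : ∀ i → adj i i ≡ false
open Graph public

_≅_ : Graph → Graph → Set
G ≅ H = Σ (Fin (size G) ↔ Fin (size H)) λ f →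
          ∀ i j → adj G i j ≡ adj H (Inverse.to f i) (Inverse.to f j)

private
  diff : ∀ {n} (i j : Fin n) → Bool
  diff i j = not (does (i ≟ j))

  diff-sym : ∀ {n} (i j : Fin n) → diff i j ≡ diff j i
  diff-sym i j with i ≟ j | j ≟ i
  ... | yes _ | yes _ = refl
  ... | no _  | no _  = refl
  ... | yes p | no q  = Data.Empty.⊥-elim (q (sym p)) where import Data.Empty
  ... | no q  | yes p = Data.Empty.⊥-elim (q (sym p)) where import Data.Empty

  diff-irr : ∀ {n} (i : Fin n) → diff i i ≡ false
  diff-irr i with i ≟ i
  ... | yes _ = refl
  ... | no q  = Data.Empty.⊥-elim (q refl) where import Data.Empty

K : ℕ → Graph
K n = record { size = n ; adj = diff ; adjSym = diff-sym ; adjIrr = diff-irr }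

complement : Graph → Graph
complement G = record { size = size G ; adj = a ; adjSym = s ; adjIrr = r }
  where
  a : Fin (size G) → Fin (size G) → Bool
  a i j = if does (i ≟ j) then false else not (adj G i j)
  s : ∀ i j → a i j ≡ a j i
  s i j with i ≟ j | j ≟ i
  ... | yes _ | yes _ = refl
  ... | no _  | no _  rewrite adjSym G i j = refl
  ... | yes p | no q  = Data.Empty.⊥-elim (q (sym p)) where import Data.Empty
  ... | no q  | yes p = Data.Empty.⊥-elim (q (sym p)) where import Data.Empty
  r : ∀ i → a i i ≡ false
  r i with i ≟ i
  ... | yes _ = refl
  ... | no q  = Data.Empty.⊥-elim (q refl) where import Data.Empty

_⊕_ : Graph → Graph → Graph
G ⊕ H = record { size = size G + size H ; adj = a ; adjSym = s ; adjIrr = r }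
  where
  a : Fin (size G + size H) → Fin (size G + size H) → Bool
  a i j with splitAt (size G) i | splitAt (size G) j
  ... | inj₁ x | inj₁ y = adj G x y
  ... | inj₂ x | inj₂ y = adj H x y
  ... | inj₁ _ | inj₂ _ = false
  ... | inj₂ _ | inj₁ _ = false
  s : ∀ i j → a i j ≡ a j i
  s i j with splitAt (size G) i | splitAt (size G) j
  ... | inj₁ x | inj₁ y = adjSym G x y
  ... | inj₂ x | inj₂ y = adjSym H x y
  ... | inj₁ _ | inj₂ _ = refl
  ... | inj₂ _ | inj₁ _ = refl
  r : ∀ i → a i i ≡ false
  r i with splitAt (size G) i
  ... | inj₁ x = adjIrr G x
  ... | inj₂ x = adjIrr H x

Kbip : ℕ → ℕ → Graph
Kbip m n = record { size = m + n ; adj = a ; adjSym = s ; adjIrr = r }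
  where
  a : Fin (m + n) → Fin (m + n) → Bool
  a i j with splitAt m i | splitAt m j
  ... | inj₁ _ | inj₁ _ = false
  ... | inj₂ _ | inj₂ _ = false
  ... | inj₁ _ | inj₂ _ = true
  ... | inj₂ _ | inj₁ _ = true
  s : ∀ i j → a i j ≡ a j i
  s i j with splitAt m i | splitAt m j
  ... | inj₁ _ | inj₁ _ = refl
  ... | inj₂ _ | inj₂ _ = refl
  ... | inj₁ _ | inj₂ _ = refl
  ... | inj₂ _ | inj₁ _ = refl
  r : ∀ i → a i i ≡ false
  r i with splitAt m i
  ... | inj₁ _ = refl
  ... | inj₂ _ = refl

⨁ : List Graph → Graph
⨁ = foldr _⊕_ (K 0)

InK : Graph → Set
InK G = ∃[ ns ] (length (filter (2 <?_) ns) ≤ 1 × G ≅ ⨁ (map K ns))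

-- Class 𝕊: forests all of whose components are stars K_{1,m} (m ≥ 0).
InS : Graph → Set
InS G = ∃[ ms ] (G ≅ ⨁ (map (Kbip 1) ms))

InKc : Graph → Set
InKc G = ∃[ H ] (InK H × G ≅ complement H)

InSc : Graph → Set
InSc G = ∃[ H ] (InS H × G ≅ complement H)

Covers : Graph → Graph → Set
Covers F₁ F₂ = (InK F₁ ⊎ InK F₂) × (InKc F₁ ⊎ InKc F₂)
             × (InS F₁ ⊎ InS F₂) × (InSc F₁ ⊎ InSc F₂)

module Submission where

-- Both live on the vertex set
-- Fin (a + b), and there K_{a,b} and K_a + K_b are complements of each other.
-- Membership in 𝕂 and 𝕂ᶜ is cheap: K_a + K_b ∈ 𝕂 as soon as a ≤ 2.  The real
-- content is in 𝕊 and 𝕊ᶜ, controlled by one invariant: a star forest contains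
-- no P₄, i.e. no walk x – y – z – w with x ≠ z and y ≠ w.  This is stable under
-- disjoint union and isomorphism, and for 𝕊ᶜ it applies to the non-edges.
-- Exhibiting a P₄ (a path through both sides of K_{a,b}, or a closed triangle
-- walk in a clique) and transporting it through the complementarity gives
--   K_{a,b} ∈ 𝕊 ⇒ a ≤ 1 ∨ b ≤ 1,      K_a + K_b ∈ 𝕊 ⇒ b ≤ 2,
--   K_{a,b} ∈ 𝕊ᶜ ⇒ b ≤ 2,              K_a + K_b ∈ 𝕊ᶜ ⇒ a ≤ 1 ∨ b ≤ 1,
-- while K_{a,b} ∈ 𝕊 for a ≤ 1 and K_2 + K_2 = 2K_2 ∈ 𝕊.

open import Defs
open import Data.Nat using (ℕ; zero; suc; _+_; _≤_; z≤n; s≤s; _<?_)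
open import Data.Nat.Properties
  using (≤-refl; ≤-trans; ≤-antisym; ≤⇒≯; +-mono-≤; +-monoʳ-≤; +-cancelʳ-≤)
open import Data.Fin using (Fin; zero; suc; splitAt; join; _↑ˡ_; _↑ʳ_; _≟_)
open import Data.Fin.Properties using (splitAt-↑ˡ; splitAt-↑ʳ; join-splitAt; ↑ʳ-injective; all?)
open import Data.Bool using (true; false; not)
open import Data.Bool.Properties using (not-involutive) renaming (_≟_ to _≟ᵇ_)
open import Data.Sum using (_⊎_; inj₁; inj₂; [_,_]′)
import Data.Sum as Sum
open import Data.Product using (_×_; _,_; proj₁)
open import Data.List using (List; []; _∷_; replicate; map; filter; length)
open import Data.List.Properties using (length-filter; filter-reject)
open import Data.Empty using (⊥-elim)
open import Relation.Nullary using (¬_; yes; no)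
open import Relation.Nullary.Decidable using (toWitness)
open import Relation.Binary.PropositionalEquality
open import Function using (id; _∘_; case_of_)
open import Function.Bundles using (_⇔_; _↔_; Inverse; Injection; mk↔ₛ′; mk⇔)
open import Function.Properties.Inverse using (↔-refl; Inverse⇒Injection)

data Side (m n : ℕ) : Fin (m + n) → Set where
  left  : (x : Fin m) → Side m n (x ↑ˡ n)
  right : (y : Fin n) → Side m n (m ↑ʳ y)

side : ∀ m n (i : Fin (m + n)) → Side m n i
side m n i = subst (Side m n) (join-splitAt m n i) (fromSplit (splitAt m i))
  where
  fromSplit : (s : Fin m ⊎ Fin n) → Side m n (join m n s)
  fromSplit (inj₁ x) = left x
  fromSplit (inj₂ y) = right y

module _ (G H : Graph) where

  ⊕-LL : ∀ x y → adj (G ⊕ H) (x ↑ˡ size H) (y ↑ˡ size H) ≡ adj G x y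
  ⊕-LL x y rewrite splitAt-↑ˡ (size G) x (size H) | splitAt-↑ˡ (size G) y (size H) = refl

  ⊕-RR : ∀ x y → adj (G ⊕ H) (size G ↑ʳ x) (size G ↑ʳ y) ≡ adj H x y
  ⊕-RR x y rewrite splitAt-↑ʳ (size G) (size H) x | splitAt-↑ʳ (size G) (size H) y = refl

  ⊕-LR : ∀ x y → adj (G ⊕ H) (x ↑ˡ size H) (size G ↑ʳ y) ≡ false
  ⊕-LR x y rewrite splitAt-↑ˡ (size G) x (size H) | splitAt-↑ʳ (size G) (size H) y = refl

  ⊕-RL : ∀ x y → adj (G ⊕ H) (size G ↑ʳ x) (y ↑ˡ size H) ≡ false
  ⊕-RL x y rewrite splitAt-↑ʳ (size G) (size H) x | splitAt-↑ˡ (size G) y (size H) = refl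

module _ (m n : ℕ) where

  bip-LL : ∀ x y → adj (Kbip m n) (x ↑ˡ n) (y ↑ˡ n) ≡ false
  bip-LL x y rewrite splitAt-↑ˡ m x n | splitAt-↑ˡ m y n = refl

  bip-RR : ∀ x y → adj (Kbip m n) (m ↑ʳ x) (m ↑ʳ y) ≡ false
  bip-RR x y rewrite splitAt-↑ʳ m n x | splitAt-↑ʳ m n y = refl

  bip-LR : ∀ x y → adj (Kbip m n) (x ↑ˡ n) (m ↑ʳ y) ≡ true
  bip-LR x y rewrite splitAt-↑ˡ m x n | splitAt-↑ʳ m n y = refl

  bip-RL : ∀ x y → adj (Kbip m n) (m ↑ʳ x) (y ↑ˡ n) ≡ true
  bip-RL x y rewrite splitAt-↑ʳ m n x | splitAt-↑ˡ m y n = refl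

K-adj : ∀ {n} (x y : Fin n) → x ≢ y → adj (K n) x y ≡ true
K-adj x y x≢y with x ≟ y
... | yes x≡y = ⊥-elim (x≢y x≡y)
... | no _    = refl

complement-adj : ∀ H i j → i ≢ j → adj (complement H) i j ≡ not (adj H i j)
complement-adj H i j i≢j with i ≟ j
... | yes i≡j = ⊥-elim (i≢j i≡j)
... | no _    = refl

Edge : (G : Graph) → Fin (size G) → Fin (size G) → Set
Edge G i j = adj G i j ≡ true

NonEdge : (G : Graph) → Fin (size G) → Fin (size G) → Set
NonEdge G i j = i ≢ j × adj G i j ≡ false

edge-distinct : ∀ G {i j} → Edge G i j → i ≢ j
edge-distinct G {i} e refl with () ← trans (sym (adjIrr G i)) e

to-injective : ∀ {m n} (f : Fin m ↔ Fin n) {x y} → Inverse.to f x ≡ Inverse.to f y → x ≡ y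
to-injective f = Injection.injective (Inverse⇒Injection f)

≅-edge : ∀ {G H} (iso : G ≅ H) {i j} → Edge G i j →
         Edge H (Inverse.to (proj₁ iso) i) (Inverse.to (proj₁ iso) j)
≅-edge (f , pres) {i} {j} e = trans (sym (pres i j)) e

≅-complement-nonedge : ∀ {G H} (iso : G ≅ complement H) {i j} → NonEdge G i j →
         Edge H (Inverse.to (proj₁ iso) i) (Inverse.to (proj₁ iso) j)
≅-complement-nonedge {G} {H} (f , pres) {i} {j} (i≢j , e) = begin
  adj H (to i) (to j)                    ≡⟨ not-involutive _ ⟨
  not (not (adj H (to i) (to j)))        ≡⟨ cong not (complement-adj H _ _ (i≢j ∘ to-injective f)) ⟨
  not (adj (complement H) (to i) (to j)) ≡⟨ cong not (pres i j) ⟨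
  not (adj G i j)                        ≡⟨ cong not e ⟩
  true                                   ∎
  where open ≡-Reasoning
        to = Inverse.to f

≅-complement : ∀ {G H} (f : Fin (size G) ↔ Fin (size H)) →
  (∀ i j → i ≢ j → adj G i j ≡ not (adj H (Inverse.to f i) (Inverse.to f j))) →
  G ≅ complement H
≅-complement {G} {H} f flips = f , preserves
  where
  to = Inverse.to f
  preserves : ∀ i j → adj G i j ≡ adj (complement H) (to i) (to j)
  preserves i j with i ≟ j
  ... | yes refl = trans (adjIrr G i) (sym (adjIrr (complement H) (to i)))
  ... | no i≢j   = trans (flips i j i≢j) (sym (complement-adj H _ _ (i≢j ∘ to-injective f)))

Edgeless : Graph → Set
Edgeless G = ∀ i j → adj G i j ≡ false

edgeless-≅ : ∀ {G H} → size G ≡ size H → Edgeless G → Edgeless H → G ≅ H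
edgeless-≅ {G} {H} same eG eH =
  subst (λ k → Fin (size G) ↔ Fin k) same ↔-refl , λ i j → trans (eG i j) (sym (eH _ _))

module _ (G : Graph) {H H′ : Graph} where

  onRight : (Fin (size H) → Fin (size H′)) → Fin (size G + size H) → Fin (size G + size H′)
  onRight f i = join (size G) (size H′) (Sum.map id f (splitAt (size G) i))

  onRight-left : ∀ f x → onRight f (x ↑ˡ size H) ≡ x ↑ˡ size H′
  onRight-left f x = cong (join (size G) (size H′) ∘ Sum.map id f) (splitAt-↑ˡ (size G) x (size H))

  onRight-right : ∀ f y → onRight f (size G ↑ʳ y) ≡ size G ↑ʳ f y
  onRight-right f y = cong (join (size G) (size H′) ∘ Sum.map id f) (splitAt-↑ʳ (size G) (size H) y)

⊕-congʳ : ∀ G {H H′} → H ≅ H′ → (G ⊕ H) ≅ (G ⊕ H′)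
⊕-congʳ G {H} {H′} (f , pres) =
  mk↔ₛ′ forth back (cancel {H} {H′} to from (Inverse.strictlyInverseˡ f))
                   (cancel {H′} {H} from to (Inverse.strictlyInverseʳ f))
  , preserves
  where
  to = Inverse.to f
  from = Inverse.from f
  g = size G
  forth = onRight G {H} {H′} to
  back = onRight G {H′} {H} from

  cancel : ∀ {A B} (u : Fin (size A) → Fin (size B)) (v : Fin (size B) → Fin (size A)) →
           (∀ y → u (v y) ≡ y) → ∀ i → onRight G {A} {B} u (onRight G {B} {A} v i) ≡ i
  cancel {A} {B} u v uv i with side g (size B) i
  ... | left x  rewrite onRight-left G {B} {A} v x = onRight-left G {A} {B} u x
  ... | right y rewrite onRight-right G {B} {A} v y | onRight-right G {A} {B} u (v y) =
    cong (g ↑ʳ_) (uv y)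

  preserves : ∀ i j → adj (G ⊕ H) i j ≡ adj (G ⊕ H′) (forth i) (forth j)
  preserves i j with side g (size H) i | side g (size H) j
  ... | left x  | left y  rewrite onRight-left G {H} {H′} to x | onRight-left G {H} {H′} to y =
    trans (⊕-LL G H x y) (sym (⊕-LL G H′ x y))
  ... | left x  | right y rewrite onRight-left G {H} {H′} to x | onRight-right G {H} {H′} to y =
    trans (⊕-LR G H x y) (sym (⊕-LR G H′ x (to y)))
  ... | right x | left y  rewrite onRight-right G {H} {H′} to x | onRight-left G {H} {H′} to y =
    trans (⊕-RL G H x y) (sym (⊕-RL G H′ (to x) y))
  ... | right x | right y rewrite onRight-right G {H} {H′} to x | onRight-right G {H} {H′} to y =
    trans (⊕-RR G H x y) (trans (pres x y) (sym (⊕-RR G H′ (to x) (to y))))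

⊕-unitʳ : ∀ G → G ≅ (G ⊕ K 0)
⊕-unitʳ G = mk↔ₛ′ (_↑ˡ 0) dropUnit dropUnit-inverse dropUnit-↑ˡ , λ i j → sym (⊕-LL G (K 0) i j)
  where
  dropUnit : Fin (size G + 0) → Fin (size G)
  dropUnit i = [ id , (λ ()) ]′ (splitAt (size G) i)

  dropUnit-↑ˡ : ∀ x → dropUnit (x ↑ˡ 0) ≡ x
  dropUnit-↑ˡ x = cong [ id , (λ ()) ]′ (splitAt-↑ˡ (size G) x 0)

  dropUnit-inverse : ∀ i → dropUnit i ↑ˡ 0 ≡ i
  dropUnit-inverse i with side (size G) 0 i
  ... | left x = cong (_↑ˡ 0) (dropUnit-↑ˡ x)

module _ (a b : ℕ) where

  bip-flips-cliques : ∀ i j → i ≢ j → adj (Kbip a b) i j ≡ not (adj (K a ⊕ K b) i j)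
  bip-flips-cliques i j i≢j with side a b i | side a b j
  ... | left x  | left y  = trans (bip-LL a b x y)
                              (cong not (sym (trans (⊕-LL (K a) (K b) x y) (K-adj x y (i≢j ∘ cong (_↑ˡ b))))))
  ... | left x  | right y = trans (bip-LR a b x y) (cong not (sym (⊕-LR (K a) (K b) x y)))
  ... | right x | left y  = trans (bip-RL a b x y) (cong not (sym (⊕-RL (K a) (K b) x y)))
  ... | right x | right y = trans (bip-RR a b x y)
                              (cong not (sym (trans (⊕-RR (K a) (K b) x y) (K-adj x y (i≢j ∘ cong (a ↑ʳ_))))))

  cliques-flip-bip : ∀ i j → i ≢ j → adj (K a ⊕ K b) i j ≡ not (adj (Kbip a b) i j)
  cliques-flip-bip i j i≢j = trans (sym (not-involutive _)) (cong not (sym (bip-flips-cliques i j i≢j)))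

  bip≅co-cliques : Kbip a b ≅ complement (K a ⊕ K b)
  bip≅co-cliques = ≅-complement {Kbip a b} {K a ⊕ K b} ↔-refl bip-flips-cliques

  cliques≅co-bip : (K a ⊕ K b) ≅ complement (Kbip a b)
  cliques≅co-bip = ≅-complement {K a ⊕ K b} {Kbip a b} ↔-refl cliques-flip-bip

  bip-edge→cliques-nonedge : ∀ {i j} → Edge (Kbip a b) i j → NonEdge (K a ⊕ K b) i j
  bip-edge→cliques-nonedge {i} {j} e =
    i≢j , trans (cliques-flip-bip i j i≢j) (cong not e)
    where i≢j = edge-distinct (Kbip a b) e

  cliques-edge→bip-nonedge : ∀ {i j} → Edge (K a ⊕ K b) i j → NonEdge (Kbip a b) i j
  cliques-edge→bip-nonedge {i} {j} e =
    i≢j , trans (bip-flips-cliques i j i≢j) (cong not e)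
    where i≢j = edge-distinct (K a ⊕ K b) e

record P₄ {n} (R : Fin n → Fin n → Set) : Set where
  field
    x y z w : Fin n
    xy : R x y
    yz : R y z
    zw : R z w
    x≢z : x ≢ z
    y≢w : y ≢ w

P₄-free : ∀ {n} (R : Fin n → Fin n → Set) → Set
P₄-free R = ∀ {x y z w} → R x y → R y z → R z w → x ≡ z ⊎ y ≡ w

P₄→¬P₄-free : ∀ {n} {R : Fin n → Fin n → Set} → P₄ R → ¬ P₄-free R
P₄→¬P₄-free p free with free (P₄.xy p) (P₄.yz p) (P₄.zw p)
... | inj₁ x≡z = P₄.x≢z p x≡z
... | inj₂ y≡w = P₄.y≢w p y≡w

module _ {m n} {R : Fin m → Fin m → Set} {S : Fin n → Fin n → Set}
         (f : Fin m → Fin n) (injective : ∀ {u v} → f u ≡ f v → u ≡ v)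
         (step : ∀ {u v} → R u v → S (f u) (f v)) where

  P₄-map : P₄ R → P₄ S
  P₄-map p = record
    { xy = step (P₄.xy p) ; yz = step (P₄.yz p) ; zw = step (P₄.zw p)
    ; x≢z = P₄.x≢z p ∘ injective ; y≢w = P₄.y≢w p ∘ injective }

  P₄-free-pull : P₄-free S → P₄-free R
  P₄-free-pull free xy yz zw =
    Sum.map injective injective (free (step xy) (step yz) (step zw))

-- A star K_{1,m} is P₄-free: every edge joins the centre to a leaf, so a walk
-- either returns to the centre (x ≡ z) or leaves it and comes back (y ≡ w).
module _ (m : ℕ) where

  private
    centre : Fin (1 + m)
    centre = zero ↑ˡ m

  leaf-to-centre : ∀ y j → Edge (Kbip 1 m) (1 ↑ʳ y) j → j ≡ centre
  leaf-to-centre y j e with side 1 m j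
  ... | left zero = refl
  ... | right c with () ← trans (sym (bip-RR 1 m y c)) e

  star-P₄-free : P₄-free (Edge (Kbip 1 m))
  star-P₄-free {x} {y} {z} {w} xy yz zw with side 1 m y
  ... | right b = inj₁ (trans (leaf-to-centre b x (trans (adjSym (Kbip 1 m) (1 ↑ʳ b) x) xy))
                              (sym (leaf-to-centre b z yz)))
  ... | left zero with side 1 m z
  ...   | left zero = ⊥-elim (edge-distinct (Kbip 1 m) {centre} {centre} yz refl)
  ...   | right c   = inj₂ (sym (leaf-to-centre c w zw))

-- Edges of a disjoint union stay inside one summand, hence P₄-freeness of the
-- edge relation and edgelessness pass to disjoint unions.
module _ (G H : Graph) where

  private
    g = size G
    h = size H

  no-edge-LR : ∀ x y → ¬ Edge (G ⊕ H) (x ↑ˡ h) (g ↑ʳ y)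
  no-edge-LR x y e with () ← trans (sym (⊕-LR G H x y)) e

  no-edge-RL : ∀ x y → ¬ Edge (G ⊕ H) (g ↑ʳ x) (y ↑ˡ h)
  no-edge-RL x y e with () ← trans (sym (⊕-RL G H x y)) e

  ⊕-P₄-free : P₄-free (Edge G) → P₄-free (Edge H) → P₄-free (Edge (G ⊕ H))
  ⊕-P₄-free freeG freeH {x} {y} {z} {w} xy yz zw with side g h x | side g h y
  ... | left a  | right b = ⊥-elim (no-edge-LR a b xy)
  ... | right a | left b  = ⊥-elim (no-edge-RL a b xy)
  ... | left a  | left b with side g h z
  ...   | right c = ⊥-elim (no-edge-LR b c yz)
  ...   | left c with side g h w
  ...     | right d = ⊥-elim (no-edge-LR c d zw)
  ...     | left d  = Sum.map (cong (_↑ˡ h)) (cong (_↑ˡ h))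
                        (freeG (trans (sym (⊕-LL G H a b)) xy) (trans (sym (⊕-LL G H b c)) yz)
                               (trans (sym (⊕-LL G H c d)) zw))
  ⊕-P₄-free freeG freeH {x} {y} {z} {w} xy yz zw | right a | right b with side g h z
  ...   | left c = ⊥-elim (no-edge-RL b c yz)
  ...   | right c with side g h w
  ...     | left d  = ⊥-elim (no-edge-RL c d zw)
  ...     | right d = Sum.map (cong (g ↑ʳ_)) (cong (g ↑ʳ_))
                        (freeH (trans (sym (⊕-RR G H a b)) xy) (trans (sym (⊕-RR G H b c)) yz)
                               (trans (sym (⊕-RR G H c d)) zw))

  ⊕-edgeless : Edgeless G → Edgeless H → Edgeless (G ⊕ H)
  ⊕-edgeless eG eH i j with side g h i | side g h j
  ... | left x  | left y  = trans (⊕-LL G H x y) (eG x y)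
  ... | left x  | right y = ⊕-LR G H x y
  ... | right x | left y  = ⊕-RL G H x y
  ... | right x | right y = trans (⊕-RR G H x y) (eH x y)

starForest : List ℕ → Graph
starForest ms = ⨁ (map (Kbip 1) ms)

starForest-P₄-free : ∀ ms → P₄-free (Edge (starForest ms))
starForest-P₄-free []       {()}
starForest-P₄-free (m ∷ ms) = ⊕-P₄-free (Kbip 1 m) (starForest ms) (star-P₄-free m) (starForest-P₄-free ms)

InS→P₄-free : ∀ {G} → InS G → P₄-free (Edge G)
InS→P₄-free {G} (ms , iso@(f , _)) =
  P₄-free-pull (Inverse.to f) (to-injective f) (≅-edge {G} {starForest ms} iso) (starForest-P₄-free ms)

InSc→P₄-free : ∀ {G} → InSc G → P₄-free (NonEdge G)
InSc→P₄-free {G} (H , inS , iso@(f , _)) =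
  P₄-free-pull (Inverse.to f) (to-injective f) (≅-complement-nonedge {G} {H} iso) (InS→P₄-free {H} inS)

bip-P₄ : ∀ k l → P₄ (Edge (Kbip (2 + k) (2 + l)))
bip-P₄ k l = record
  { x = p₀ ↑ˡ (2 + l) ; y = (2 + k) ↑ʳ q₀ ; z = p₁ ↑ˡ (2 + l) ; w = (2 + k) ↑ʳ q₁
  ; xy = bip-LR (2 + k) (2 + l) p₀ q₀
  ; yz = bip-RL (2 + k) (2 + l) q₀ p₁
  ; zw = bip-LR (2 + k) (2 + l) p₁ q₁
  ; x≢z = λ ()
  ; y≢w = λ e → case ↑ʳ-injective (2 + k) q₀ q₁ e of λ () }
  where
  p₀ p₁ : Fin (2 + k)
  p₀ = zero
  p₁ = suc zero
  q₀ q₁ : Fin (2 + l)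
  q₀ = zero
  q₁ = suc zero

triangle-P₄ : ∀ a l → P₄ (Edge (K a ⊕ K (3 + l)))
triangle-P₄ a l = P₄-map (a ↑ʳ_) (↑ʳ-injective a _ _) (λ e → trans (⊕-RR (K a) (K (3 + l)) _ _) e) triangle
  where
  triangle : P₄ (Edge (K (3 + l)))
  triangle = record { x = zero ; y = suc zero ; z = suc (suc zero) ; w = zero
                    ; xy = refl ; yz = refl ; zw = refl ; x≢z = λ () ; y≢w = λ () }

bip-in-S : ∀ a b → InS (Kbip a b) → a ≤ 1 ⊎ b ≤ 1
bip-in-S 0             _             _ = inj₁ z≤n
bip-in-S 1             _             _ = inj₁ (s≤s z≤n)
bip-in-S (suc (suc _)) 0             _ = inj₂ z≤n
bip-in-S (suc (suc _)) 1             _ = inj₂ (s≤s z≤n)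
bip-in-S (suc (suc k)) (suc (suc l)) s =
  ⊥-elim (P₄→¬P₄-free (bip-P₄ k l) (InS→P₄-free {Kbip (2 + k) (2 + l)} s))

cliques-in-Sc : ∀ a b → InSc (K a ⊕ K b) → a ≤ 1 ⊎ b ≤ 1
cliques-in-Sc 0             _             _ = inj₁ z≤n
cliques-in-Sc 1             _             _ = inj₁ (s≤s z≤n)
cliques-in-Sc (suc (suc _)) 0             _ = inj₂ z≤n
cliques-in-Sc (suc (suc _)) 1             _ = inj₂ (s≤s z≤n)
cliques-in-Sc (suc (suc k)) (suc (suc l)) s =
  ⊥-elim (P₄→¬P₄-free (P₄-map id id (bip-edge→cliques-nonedge (2 + k) (2 + l)) (bip-P₄ k l))
                      (InSc→P₄-free {K (2 + k) ⊕ K (2 + l)} s))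

cliques-in-S : ∀ a b → InS (K a ⊕ K b) → b ≤ 2
cliques-in-S _ 0                   _ = z≤n
cliques-in-S _ 1                   _ = s≤s z≤n
cliques-in-S _ 2                   _ = s≤s (s≤s z≤n)
cliques-in-S a (suc (suc (suc l))) s =
  ⊥-elim (P₄→¬P₄-free (triangle-P₄ a l) (InS→P₄-free {K a ⊕ K (3 + l)} s))

bip-in-Sc : ∀ a b → InSc (Kbip a b) → b ≤ 2
bip-in-Sc _ 0                   _ = z≤n
bip-in-Sc _ 1                   _ = s≤s z≤n
bip-in-Sc _ 2                   _ = s≤s (s≤s z≤n)
bip-in-Sc a (suc (suc (suc l))) s =
  ⊥-elim (P₄→¬P₄-free (P₄-map id id (cliques-edge→bip-nonedge a (3 + l)) (triangle-P₄ a l))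
                      (InSc→P₄-free {Kbip a (3 + l)} s))

isolated : ℕ → Graph
isolated n = starForest (replicate n 0)

isolated-size : ∀ n → size (isolated n) ≡ n
isolated-size zero    = refl
isolated-size (suc n) = cong suc (isolated-size n)

isolated-edgeless : ∀ n → Edgeless (isolated n)
isolated-edgeless zero    ()
isolated-edgeless (suc n) = ⊕-edgeless (Kbip 1 0) (isolated n) (λ { zero zero → refl }) (isolated-edgeless n)

bip-S : ∀ a b → a ≤ 1 → InS (Kbip a b)
bip-S 0 b z≤n = replicate b 0 , edgeless-≅ {Kbip 0 b} {isolated b} (sym (isolated-size b)) (λ _ _ → refl) (isolated-edgeless b)
bip-S 1 b (s≤s z≤n) = b ∷ [] , ⊕-unitʳ (Kbip 1 b)

cliques-Sc : ∀ a b → a ≤ 1 → InSc (K a ⊕ K b)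
cliques-Sc a b a≤1 = Kbip a b , bip-S a b a≤1 , cliques≅co-bip a b

cliques-K : ∀ a b → a ≤ 2 → InK (K a ⊕ K b)
cliques-K a b a≤2 = a ∷ b ∷ [] , atMostOneLarge , ⊕-congʳ (K a) (⊕-unitʳ (K b))
  where
  atMostOneLarge : length (filter (2 <?_) (a ∷ b ∷ [])) ≤ 1
  atMostOneLarge = subst (λ xs → length xs ≤ 1) (sym (filter-reject (2 <?_) (≤⇒≯ a≤2)))
                         (length-filter (2 <?_) (b ∷ []))

bip-Kc : ∀ a b → a ≤ 2 → InKc (Kbip a b)
bip-Kc a b a≤2 = K a ⊕ K b , cliques-K a b a≤2 , bip≅co-cliques a b

2K₂-S : InS (K 2 ⊕ K 2)
2K₂-S = 1 ∷ 1 ∷ [] , ↔-refl , toWitness {a? = all? λ i → all? λ j → adj (K 2 ⊕ K 2) i j ≟ᵇ adj (starForest (1 ∷ 1 ∷ [])) i j} _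

K₂₂-Sc : InSc (Kbip 2 2)
K₂₂-Sc = K 2 ⊕ K 2 , 2K₂-S , bip≅co-cliques 2 2

sum-too-small : ∀ {a b} → a ≤ 1 → b ≤ 2 → ¬ 4 ≤ a + b
sum-too-small a≤1 b≤2 4≤a+b with ≤-trans 4≤a+b (+-mono-≤ a≤1 b≤2)
... | s≤s (s≤s (s≤s ()))

both-two : ∀ {a b} → a ≤ b → b ≤ 2 → 4 ≤ a + b → a ≡ 2 × b ≡ 2
both-two {a} {b} a≤b b≤2 4≤a+b =
  ≤-antisym (≤-trans a≤b b≤2) 2≤a , ≤-antisym b≤2 (≤-trans 2≤a a≤b)
  where
  2≤a : 2 ≤ a
  2≤a = +-cancelʳ-≤ 2 2 a (≤-trans 4≤a+b (+-monoʳ-≤ a b≤2))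

smaller≤1 : ∀ {a b} → a ≤ b → a ≤ 1 ⊎ b ≤ 1 → a ≤ 1
smaller≤1 a≤b = [ id , ≤-trans a≤b ]′

lemma3p6 : (a₁ a₂ b₁ b₂ : ℕ) → a₁ ≤ a₂ → b₁ ≤ b₂ → 4 ≤ a₁ + a₂ → 4 ≤ b₁ + b₂ →
    (Covers (Kbip a₁ a₂) (K b₁ ⊕ K b₂)
      ⇔ ((a₁ ≤ 1 × b₁ ≤ 1) ⊎ (a₁ ≡ 2 × a₂ ≡ 2 × b₁ ≡ 2 × b₂ ≡ 2)))
lemma3p6 a₁ a₂ b₁ b₂ a₁≤a₂ b₁≤b₂ 4≤a 4≤b = mk⇔ necessary sufficient
  where
  S₁⇒a₁≤1 : InS (Kbip a₁ a₂) → a₁ ≤ 1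
  S₁⇒a₁≤1 = smaller≤1 a₁≤a₂ ∘ bip-in-S a₁ a₂

  Sc₂⇒b₁≤1 : InSc (K b₁ ⊕ K b₂) → b₁ ≤ 1
  Sc₂⇒b₁≤1 = smaller≤1 b₁≤b₂ ∘ cliques-in-Sc b₁ b₂

  necessary : Covers (Kbip a₁ a₂) (K b₁ ⊕ K b₂) →
              (a₁ ≤ 1 × b₁ ≤ 1) ⊎ (a₁ ≡ 2 × a₂ ≡ 2 × b₁ ≡ 2 × b₂ ≡ 2)
  necessary (_ , _ , inj₁ S₁ , inj₁ Sc₁) = ⊥-elim (sum-too-small (S₁⇒a₁≤1 S₁) (bip-in-Sc a₁ a₂ Sc₁) 4≤a)
  necessary (_ , _ , inj₁ S₁ , inj₂ Sc₂) = inj₁ (S₁⇒a₁≤1 S₁ , Sc₂⇒b₁≤1 Sc₂)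
  necessary (_ , _ , inj₂ S₂ , inj₂ Sc₂) = ⊥-elim (sum-too-small (Sc₂⇒b₁≤1 Sc₂) (cliques-in-S b₁ b₂ S₂) 4≤b)
  necessary (_ , _ , inj₂ S₂ , inj₁ Sc₁)
    with both-two a₁≤a₂ (bip-in-Sc a₁ a₂ Sc₁) 4≤a | both-two b₁≤b₂ (cliques-in-S b₁ b₂ S₂) 4≤b
  ... | a₁≡2 , a₂≡2 | b₁≡2 , b₂≡2 = inj₂ (a₁≡2 , a₂≡2 , b₁≡2 , b₂≡2)

  sufficient : (a₁ ≤ 1 × b₁ ≤ 1) ⊎ (a₁ ≡ 2 × a₂ ≡ 2 × b₁ ≡ 2 × b₂ ≡ 2) →
               Covers (Kbip a₁ a₂) (K b₁ ⊕ K b₂)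
  sufficient (inj₁ (a₁≤1 , b₁≤1)) =
    inj₂ (cliques-K b₁ b₂ (≤-trans b₁≤1 (s≤s z≤n))) , inj₁ (bip-Kc a₁ a₂ (≤-trans a₁≤1 (s≤s z≤n))) ,
    inj₁ (bip-S a₁ a₂ a₁≤1) , inj₂ (cliques-Sc b₁ b₂ b₁≤1)
  sufficient (inj₂ (refl , refl , refl , refl)) =
    inj₂ (cliques-K 2 2 ≤-refl) , inj₁ (bip-Kc 2 2 ≤-refl) , inj₂ 2K₂-S , inj₁ K₂₂-Sc
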